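{- Let $P$ be a finite poset, let $C=\{c_1\prec\cdots\prec c_k\}$ be a longest chain of $P$, use the notation below, and let $i\in\{0,\dots,k-2\}$. (1) For $I\in\mathcal{I}_i(P)$, the set $I\cup\{c_{i+1},c_{i+2}\}$ is an ideal of $P$ if and only if $L_{i+1}\cup L_{i+2}\subseteq I$. Therefore $U_i\cup\{c_{i+1},c_{i+2}\}\in\mathcal{I}_{i+2}(P)$ and $U_i\setminus D_{i+2}\in\mathcal{I}(P_{i+2})$. (2) For $I\in\mathcal{I}_{i+2}(P)$, the set $I\setminus\{c_{i+1},c_{i+2}\}$ is an ideal of $P$ if and only if $(S_{i+1}\cup S_{i+2})\cap I=\emptyset$. Therefore $D_{i+2}\setminus\{c_{i+1},c_{i+2}\}\in\mathcal{I}_i(P)$ and $D_{i+2}\setminus(D_i\cup\{c_{i+1},c_{i+2}\})\in\mathcal{I}(P_i)$.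
   Context: $P$ is a finite partially ordered set with order $\preceq$; an ideal is a downward-closed subset and $\mathcal{I}(Q)$ is the set of ideals of a poset $Q$. Add virtual elements $c_0,c_{k+1}$ with $c_0\prec u\prec c_{k+1}$ for all $u\in P$. For an ideal $I$ of $P$, $\zeta(I)=\max\{j:c_j\in I\}$ ($\zeta(I)=0$ if $I\cap C=\emptyset$) and $\mathcal{I}_j(P)=\{I\in\mathcal{I}(P):\zeta(I)=j\}$. For $j\in\{0,\dots,k\}$: $D_j=\{u\in P:u\preceq c_j\}$ ($D_0=\emptyset$), $U_j=\{u\in P:u\not\succeq c_{j+1}\}$, and $P_j$ is the subposet of all $u\in P$ with $u\not\preceq c_j$ and $u\not\succeq c_{j+1}$. For $u\in P$, $s_u=\max\{j: c_j\preceq u\}$ and $l_u=\min\{j: u\preceq c_j\}$ (indices ranging over $\{0,\dots,k+1\}$). For $j\in\{0,\dots,k+1\}$, $S_j=\{u\in P\setminus C: s_u=j\}$ and $L_j=\{u\in P\setminus C: l_u=j\}$. -}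

module Defs where

open import Level using (0ℓ)
open import Data.Nat using (ℕ; zero; suc; _<_; _≤_)
open import Data.Fin using (Fin; fromℕ<)
import Data.Fin as F
open import Data.Product using (Σ; ∃; _×_)
open import Data.Sum using (_⊎_)
open import Data.Unit using (⊤)
open import Data.Empty using (⊥)
open import Relation.Nullary using (¬_)
open import Relation.Unary using (Pred)
open import Relation.Binary using (Rel)
open import Relation.Binary.PropositionalEquality using (_≡_; _≢_)

Strict : ∀ {n} → Rel (Fin n) 0ℓ → Rel (Fin n) 0ℓ
Strict _≼_ a b = a ≼ b × a ≢ b

IsChain : ∀ {n} → Rel (Fin n) 0ℓ → ∀ {m} → (Fin m → Fin n) → Set
IsChain _≼_ g = ∀ a b → a F.< b → Strict _≼_ (g a) (g b)

IsLongestChain : ∀ {n} → Rel (Fin n) 0ℓ → ∀ {k} → (Fin k → Fin n) → Set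
IsLongestChain {n} _≼_ {k} c =
  IsChain _≼_ c × (∀ m (g : Fin m → Fin n) → IsChain _≼_ g → m ≤ k)

-- Notation relative to the chain C = {c_1 ≺ ... ≺ c_k}; the Agda function
-- c is 0-based, so the paper's c_j (1 ≤ j ≤ k) is  c (j - 1).
-- c_0 and c_{k+1} are virtual with c_0 ≺ u ≺ c_{k+1} for all u.
module Notation {n : ℕ} (_≼_ : Rel (Fin n) 0ℓ) {k : ℕ} (c : Fin k → Fin n) where

  -- u = c_j  (only possible for 1 ≤ j ≤ k)
  IsC : ℕ → Fin n → Set
  IsC zero u = ⊥
  IsC (suc j) u = Σ (j < k) λ p → u ≡ c (fromℕ< p)

  InC : Pred (Fin n) 0ℓ
  InC u = ∃ λ t → u ≡ c t

  -- c_j ≼ u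
  CLe : ℕ → Fin n → Set
  CLe zero u = ⊤
  CLe (suc j) u = Σ (j < k) λ p → c (fromℕ< p) ≼ u

  -- u ≼ c_j
  LeC : Fin n → ℕ → Set
  LeC u zero = ⊥
  LeC u (suc j) = (Σ (j < k) λ p → u ≼ c (fromℕ< p)) ⊎ (j ≡ k)

  IsIdeal : Pred (Fin n) 0ℓ → Set
  IsIdeal I = ∀ {u v} → v ≼ u → I u → I v

  IsIdealOf : Pred (Fin n) 0ℓ → Pred (Fin n) 0ℓ → Set
  IsIdealOf Q X = (∀ u → X u → Q u) × (∀ {u v} → Q u → Q v → v ≼ u → X u → X v)

  -- ζ(I) = j, where ζ(I) = max{ j : c_j ∈ I } and ζ(I) = 0 if I ∩ C = ∅
  Zeta : Pred (Fin n) 0ℓ → ℕ → Set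
  Zeta I j = (j ≡ 0 ⊎ (∃ λ u → IsC j u × I u)) × (∀ m u → IsC m u → I u → m ≤ j)

  InIdj : ℕ → Pred (Fin n) 0ℓ → Set
  InIdj j I = IsIdeal I × Zeta I j

  D : ℕ → Pred (Fin n) 0ℓ
  D j u = LeC u j

  U : ℕ → Pred (Fin n) 0ℓ
  U j u = ¬ CLe (suc j) u

  Psub : ℕ → Pred (Fin n) 0ℓ
  Psub j u = ¬ LeC u j × ¬ CLe (suc j) u

  SIs : Fin n → ℕ → Set
  SIs u j = CLe j u × (∀ m → CLe m u → m ≤ j)

  -- l_u = j  (indices range over 0 .. k+1)
  LIs : Fin n → ℕ → Set
  LIs u j = j ≤ suc k × LeC u j × (∀ m → m ≤ suc k → LeC u m → j ≤ m)

  S : ℕ → Pred (Fin n) 0ℓ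
  S j u = ¬ InC u × SIs u j

  L : ℕ → Pred (Fin n) 0ℓ
  L j u = ¬ InC u × LIs u j

  Pair : ℕ → Pred (Fin n) 0ℓ
  Pair i u = IsC (suc i) u ⊎ IsC (suc (suc i)) u

{-# OPTIONS --safe #-}
module Submission where

-- A longest chain is saturated: an element strictly between c_{i+1} and c_{i+2} could be
-- inserted into C, giving a longer chain. Hence {c_{i+1}, c_{i+2}} is the whole interval
-- [c_{i+1}, c_{i+2}]. For I ∈ 𝓘_i, closing I ∪ {c_{i+1}, c_{i+2}} downwards only adds
-- elements of ↓c_{i+2} outside D_i ∪ ↑c_{i+1}; these are off the chain and have
-- l ∈ {i+1, i+2}. Dually, for I ∈ 𝓘_{i+2}, the set I ∖ {c_{i+1}, c_{i+2}} fails to be an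
-- ideal only at elements of I above c_{i+1} other than c_{i+1}, c_{i+2}; these are off the
-- chain and have s ∈ {i+1, i+2}.

open import Defs
open import Level using (0ℓ)
open import Data.Nat using (ℕ; zero; suc; _+_; _≤_; _<_; z≤n; s≤s)
import Data.Nat.Properties as ℕ
open import Data.Fin using (Fin; zero; suc; toℕ; fromℕ<; _≟_)
open import Data.Fin.Properties using (toℕ-fromℕ<; fromℕ<-toℕ; toℕ<n; toℕ-injective)
open import Data.Vec.Functional using (insertAt; tail)
open import Data.Product using (_×_; _,_; proj₁; proj₂; ∃)
open import Data.Sum using (_⊎_; inj₁; inj₂; [_,_]′)
open import Data.Unit using (tt)
open import Data.Empty using (⊥; ⊥-elim)
open import Relation.Nullary using (¬_; Dec; yes; no)
open import Relation.Nullary.Decidable using (map′)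
open import Relation.Unary using (Pred; _∪_; _∩_; _∖_; _⊆_; Empty)
open import Relation.Binary using (Rel; IsPartialOrder; Decidable)
import Relation.Binary.Construct.NonStrictToStrict as ToStrict
open import Relation.Binary.PropositionalEquality using (_≡_; refl; sym; trans; cong; subst)
open import Function using (_∘_)
open import Function.Bundles using (_⇔_; mk⇔)

insertAt-preserves : ∀ {a ℓ} {A : Set a} (P : Pred A ℓ) {m} (xs : Fin m → A) pos {v} →
  P v → (∀ j → P (xs j)) → ∀ j → P (insertAt xs pos v j)
insertAt-preserves P xs zero Pv Pxs zero = Pv
insertAt-preserves P xs zero Pv Pxs (suc j) = Pxs j
insertAt-preserves P {suc m} xs (suc pos) Pv Pxs zero = Pxs zero
insertAt-preserves P {suc m} xs (suc pos) Pv Pxs (suc j) =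
  insertAt-preserves P (tail xs) pos Pv (Pxs ∘ suc) j

module _ {n} (_≼_ : Rel (Fin n) 0ℓ) where

  insertAt-isChain : ∀ {k} {g : Fin k → Fin n} (pos : Fin (suc k)) {v} → IsChain _≼_ g →
    (∀ a → toℕ a < toℕ pos → Strict _≼_ (g a) v) →
    (∀ a → toℕ pos ≤ toℕ a → Strict _≼_ v (g a)) →
    IsChain _≼_ (insertAt g pos v)
  insertAt-isChain zero chain below above zero (suc b) _ = above b z≤n
  insertAt-isChain zero chain below above (suc a) (suc b) (s≤s a<b) = chain a b a<b
  insertAt-isChain {suc k} {g} (suc pos) chain below above zero (suc b) _ =
    insertAt-preserves (Strict _≼_ (g zero)) (tail g) pos
      (below zero (s≤s z≤n)) (λ a → chain zero (suc a) (s≤s z≤n)) b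
  insertAt-isChain {suc k} (suc pos) chain below above (suc a) (suc b) (s≤s a<b) =
    insertAt-isChain pos (λ a b → chain (suc a) (suc b) ∘ s≤s)
      (λ a → below (suc a) ∘ s≤s) (λ a → above (suc a) ∘ s≤s) a b a<b

module ChainFacts {n} {_≼_ : Rel (Fin n) 0ℓ} (po : IsPartialOrder _≡_ _≼_)
  {k} {c : Fin k → Fin n} (chain : IsChain _≼_ c) where

  open IsPartialOrder po using (reflexive; antisym) renaming (trans to ≼-trans)
  open Notation _≼_ c

  C : ∀ j → .(j < k) → Fin n
  C j p = c (fromℕ< p)

  c-mono-≤ : ∀ {a b} → toℕ a ≤ toℕ b → c a ≼ c b
  c-mono-≤ {a} {b} a≤b with ℕ.m≤n⇒m<n∨m≡n a≤b
  ... | inj₁ a<b = proj₁ (chain a b a<b)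
  ... | inj₂ a≡b = reflexive (cong c (toℕ-injective a≡b))

  C-mono-≤ : ∀ {j j'} (p : j < k) (q : j' < k) → j ≤ j' → C j p ≼ C j' q
  C-mono-≤ p q j≤j' =
    c-mono-≤ (subst (_≤ _) (sym (toℕ-fromℕ< p)) (subst (_ ≤_) (sym (toℕ-fromℕ< q)) j≤j'))

  C-cancel-≤ : ∀ {j j'} (p : j < k) (q : j' < k) → C j p ≼ C j' q → j ≤ j'
  C-cancel-≤ p q Cj≼Cj' = ℕ.≮⇒≥ λ j'<j →
    ToStrict.<⇒≱ _≡_ _≼_ antisym (C-mono-< q p j'<j) Cj≼Cj'
    where
    C-mono-< : ∀ {j j'} (p : j < k) (q : j' < k) → j < j' → Strict _≼_ (C j p) (C j' q)
    C-mono-< p q j<j' = chain (fromℕ< p) (fromℕ< q)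
      (subst (_< _) (sym (toℕ-fromℕ< p)) (subst (_ <_) (sym (toℕ-fromℕ< q)) j<j'))

  IsC⇒InC : ∀ {m u} → IsC m u → InC u
  IsC⇒InC {suc m} (p , u≡C) = fromℕ< p , u≡C

  InC⇒IsC : ∀ {u} → InC u → ∃ λ m → IsC m u
  InC⇒IsC (t , u≡ct) = suc (toℕ t) , toℕ<n t , trans u≡ct (cong c (sym (fromℕ<-toℕ t _)))

  ≼C⇒D : ∀ {j u} (p : j < k) → u ≼ C j p → D (suc j) u
  ≼C⇒D p u≼C = inj₁ (p , u≼C)

  D⇒≼C : ∀ {j u} (p : j < k) → D (suc j) u → u ≼ C j p
  D⇒≼C p (inj₁ (_ , u≼C)) = u≼C
  D⇒≼C p (inj₂ refl) = ⊥-elim (ℕ.<-irrefl refl p)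

  D-isIdeal : ∀ {j} → IsIdeal (D j)
  D-isIdeal {suc j} v≼u (inj₁ (p , u≼C)) = inj₁ (p , ≼-trans v≼u u≼C)
  D-isIdeal {suc j} v≼u (inj₂ j≡k) = inj₂ j≡k

  D-mono : ∀ {m j} → m ≤ j → j ≤ k → D m ⊆ D j
  D-mono {suc m} {suc j} (s≤s m≤j) j<k (inj₁ (p , u≼C)) =
    ≼C⇒D j<k (≼-trans u≼C (C-mono-≤ p j<k m≤j))
  D-mono {suc m} {suc j} (s≤s m≤j) j<k (inj₂ refl) =
    ⊥-elim (ℕ.<-irrefl refl (ℕ.≤-<-trans m≤j j<k))

  CLe-upward : ∀ {j u v} → CLe j v → v ≼ u → CLe j u
  CLe-upward {zero} _ _ = tt
  CLe-upward {suc j} (p , C≼v) v≼u = p , ≼-trans C≼v v≼u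

  CLe-antimono : ∀ {m j u} → m ≤ j → CLe j u → CLe m u
  CLe-antimono {zero} _ _ = tt
  CLe-antimono {suc m} {suc j} (s≤s m≤j) (p , C≼u) = m<k , ≼-trans (C-mono-≤ m<k p m≤j) C≼u
    where m<k = ℕ.≤-<-trans m≤j p

  U-isIdeal : ∀ {j} → IsIdeal (U j)
  U-isIdeal v≼u Uu C≼v = Uu (CLe-upward C≼v v≼u)

  IsC⇒D : ∀ {m j u} → IsC m u → m ≤ j → j ≤ k → D j u
  IsC⇒D {suc m} {suc j} (p , refl) (s≤s m≤j) j<k = ≼C⇒D j<k (C-mono-≤ p j<k m≤j)

  IsC∩D⇒≤ : ∀ {m j u} → IsC m u → D j u → m ≤ j
  IsC∩D⇒≤ {suc m} {suc j} (p , refl) (inj₁ (q , C≼C)) = s≤s (C-cancel-≤ p q C≼C)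
  IsC∩D⇒≤ {suc m} {suc j} (p , refl) (inj₂ refl) = s≤s (ℕ.<⇒≤ p)

  IsC∖CLe⇒D : ∀ {m j u} → IsC m u → j < k → ¬ CLe (suc j) u → D j u
  IsC∖CLe⇒D {suc m} (p , refl) j<k ¬C≼u =
    IsC⇒D (p , refl) (ℕ.≰⇒> λ j≤m → ¬C≼u (j<k , C-mono-≤ j<k p j≤m)) (ℕ.<⇒≤ j<k)

  InIdj⇒D⊆ : ∀ {j I} → InIdj j I → D j ⊆ I
  InIdj⇒D⊆ {suc j} (I-ideal , inj₂ (_ , (_ , refl) , I∋C) , _) (inj₁ (_ , v≼C)) = I-ideal v≼C I∋C
  InIdj⇒D⊆ {suc j} (_ , inj₂ (_ , (j<k , _) , _) , _) (inj₂ refl) = ⊥-elim (ℕ.<-irrefl refl j<k)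

  InIdj⇒CLe-bound : ∀ {j I u m} → InIdj j I → I u → CLe m u → m ≤ j
  InIdj⇒CLe-bound {m = zero} _ _ _ = z≤n
  InIdj⇒CLe-bound {m = suc m} (I-ideal , _ , bound) Iu (p , C≼u) =
    bound (suc m) _ (p , refl) (I-ideal C≼u Iu)

  D⊆⇒ζ≥ : ∀ {j} {I : Pred (Fin n) 0ℓ} → j ≤ k → D j ⊆ I → j ≡ 0 ⊎ ∃ λ u → IsC j u × I u
  D⊆⇒ζ≥ {zero} _ _ = inj₁ refl
  D⊆⇒ζ≥ {suc j} j<k D⊆I = inj₂ (C j j<k , (j<k , refl) , D⊆I (≼C⇒D j<k (reflexive refl)))

  LIs-intro : ∀ {j u} → j ≤ k → D (suc j) u → ¬ D j u → LIs u (suc j)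
  LIs-intro j≤k Du ¬Du =
    s≤s j≤k , Du , λ m _ Dm → ℕ.≮⇒≥ λ m<sj → ¬Du (D-mono (ℕ.≤-pred m<sj) j≤k Dm)

  SIs-intro : ∀ {j u} → CLe j u → ¬ CLe (suc j) u → SIs u j
  SIs-intro C≼u ¬C≼u = C≼u , λ m Cm≼u → ℕ.≮⇒≥ λ j<m → ¬C≼u (CLe-antimono j<m Cm≼u)

  ∖-isIdealOf : ∀ {X Y Q : Pred (Fin n) 0ℓ} → IsIdeal X → X ∖ Y ⊆ Q → (∀ {u} → Q u → ¬ Y u) →
    IsIdealOf Q (X ∖ Y)
  ∖-isIdealOf X-ideal X∖Y⊆Q Q⊆∁Y = (λ _ → X∖Y⊆Q) , λ _ Qv v≼u (Xu , _) → X-ideal v≼u Xu , Q⊆∁Y Qv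

module LongestChain {n} {_≼_ : Rel (Fin n) 0ℓ} (po : IsPartialOrder _≡_ _≼_) (_≼?_ : Decidable _≼_)
  {k} {c : Fin k → Fin n} (longest : IsLongestChain _≼_ c) where

  open IsPartialOrder po using (reflexive; antisym; ≤-respˡ-≈; ≤-respʳ-≈)
    renaming (trans to ≼-trans)
  open Notation _≼_ c
  open ChainFacts po (proj₁ longest)

  nothing-strictly-between : ∀ {m v} (p : m < k) (q : suc m < k) →
    Strict _≼_ (C m p) v → Strict _≼_ v (C (suc m) q) → ⊥
  nothing-strictly-between {m} {v} p q C≺v v≺C =
    ℕ.n≮n k (proj₂ longest (suc k) _
      (insertAt-isChain _≼_ (suc (fromℕ< p)) (proj₁ longest) below above))
    where
    below : ∀ a → toℕ a < suc (toℕ (fromℕ< p)) → Strict _≼_ (c a) v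
    below a a≤m = ToStrict.≤-<-trans _≡_ _≼_ ≼-trans antisym ≤-respˡ-≈ (c-mono-≤ (ℕ.≤-pred a≤m)) C≺v
    above : ∀ a → suc (toℕ (fromℕ< p)) ≤ toℕ a → Strict _≼_ v (c a)
    above a m<a = ToStrict.<-≤-trans _≡_ _≼_ sym ≼-trans antisym ≤-respʳ-≈ v≺C
      (c-mono-≤ (subst (_≤ toℕ a) (trans (cong suc (toℕ-fromℕ< p)) (sym (toℕ-fromℕ< q))) m<a))

  D? : ∀ {j} → j ≤ k → ∀ u → Dec (D j u)
  D? {zero} _ u = no λ ()
  D? {suc j} j<k u = map′ (≼C⇒D j<k) (D⇒≼C j<k) (u ≼? C j j<k)

  module Consecutive (i : ℕ) (i+1<k : suc i < k) where

    i<k : i < k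
    i<k = ℕ.<-trans (ℕ.n<1+n i) i+1<k

    -- the paper's c_{i+1} and c_{i+2}
    A B : Fin n
    A = C i i<k
    B = C (suc i) i+1<k

    A∈Pair : Pair i A
    A∈Pair = inj₁ (i<k , refl)

    B∈Pair : Pair i B
    B∈Pair = inj₂ (i+1<k , refl)

    Pair⇒InC : ∀ {u} → Pair i u → InC u
    Pair⇒InC = [ IsC⇒InC , IsC⇒InC ]′

    Pair⇒between : ∀ {u} → Pair i u → A ≼ u × u ≼ B
    Pair⇒between (inj₁ (_ , refl)) = reflexive refl , C-mono-≤ i<k i+1<k (ℕ.n≤1+n i)
    Pair⇒between (inj₂ (_ , refl)) = C-mono-≤ i<k i+1<k (ℕ.n≤1+n i) , reflexive refl

    between⇒Pair : ∀ {u} → A ≼ u → u ≼ B → Pair i u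
    between⇒Pair {u} A≼u u≼B with u ≟ A | u ≟ B
    ... | yes u≡A | _ = inj₁ (i<k , u≡A)
    ... | no _ | yes u≡B = inj₂ (i+1<k , u≡B)
    ... | no u≢A | no u≢B =
      ⊥-elim (nothing-strictly-between i<k i+1<k (A≼u , u≢A ∘ sym) (u≼B , u≢B))

    D₂⇒≼B : ∀ {u} → D (suc (suc i)) u → u ≼ B
    D₂⇒≼B = D⇒≼C i+1<k

    D₂∩↑A⊆Pair : ∀ {u} → A ≼ u → D (suc (suc i)) u → Pair i u
    D₂∩↑A⊆Pair A≼u = between⇒Pair A≼u ∘ D₂⇒≼B

    L∪L⇒≼B : ∀ {u} → (L (suc i) ∪ L (suc (suc i))) u → u ≼ B
    L∪L⇒≼B (inj₁ (_ , _ , Du , _)) = D₂⇒≼B (D-mono (ℕ.n≤1+n _) i+1<k Du)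
    L∪L⇒≼B (inj₂ (_ , _ , Du , _)) = D₂⇒≼B Du

    S∪S⇒A≼ : ∀ {u} → (S (suc i) ∪ S (suc (suc i))) u → A ≼ u
    S∪S⇒A≼ (inj₁ (_ , (_ , A≼u) , _)) = A≼u
    S∪S⇒A≼ (inj₂ (_ , C≼u , _)) = proj₂ (CLe-antimono (ℕ.n≤1+n _) C≼u)

    ∉D∪↑A⇒∉C : ∀ {v} → ¬ D i v → ¬ A ≼ v → ¬ InC v
    ∉D∪↑A⇒∉C ¬Dv A⋠v v∈C = ¬Dv (IsC∖CLe⇒D (proj₂ (InC⇒IsC v∈C)) i<k (A⋠v ∘ proj₂))

    ↓B∖[D∪↑A]⊆L∪L : ∀ {v} → ¬ D i v → ¬ A ≼ v → v ≼ B → (L (suc i) ∪ L (suc (suc i))) v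
    ↓B∖[D∪↑A]⊆L∪L {v} ¬Dv A⋠v v≼B with v ≼? A
    ... | yes v≼A = inj₁ (∉D∪↑A⇒∉C ¬Dv A⋠v , LIs-intro (ℕ.<⇒≤ i<k) (≼C⇒D i<k v≼A) ¬Dv)
    ... | no v⋠A = inj₂ (∉D∪↑A⇒∉C ¬Dv A⋠v , LIs-intro i<k (≼C⇒D i+1<k v≼B) (v⋠A ∘ D⇒≼C i<k))

    ∪Pair-isIdeal⇔ : ∀ I → InIdj i I → IsIdeal (I ∪ Pair i) ⇔ (L (suc i) ∪ L (suc (suc i))) ⊆ I
    ∪Pair-isIdeal⇔ I I∈𝓘ᵢ = mk⇔ L∪L⊆I λ L∪L⊆I v≼u →
      [ inj₁ ∘ proj₁ I∈𝓘ᵢ v≼u , ↓B⊆I∪Pair L∪L⊆I ∘ ≼-trans v≼u ∘ proj₂ ∘ Pair⇒between ]′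
      where
      L∪L⊆I : IsIdeal (I ∪ Pair i) → (L (suc i) ∪ L (suc (suc i))) ⊆ I
      L∪L⊆I J-ideal {u} Lu with J-ideal (L∪L⇒≼B Lu) (inj₂ B∈Pair)
      ... | inj₁ Iu = Iu
      ... | inj₂ Pu = ⊥-elim ([ proj₁ , proj₁ ]′ Lu (Pair⇒InC Pu))
      ↓B⊆I∪Pair : (L (suc i) ∪ L (suc (suc i))) ⊆ I → ∀ {v} → v ≼ B → (I ∪ Pair i) v
      ↓B⊆I∪Pair L∪L⊆I {v} v≼B with D? (ℕ.<⇒≤ i<k) v | A ≼? v
      ... | yes Dv | _ = inj₁ (InIdj⇒D⊆ I∈𝓘ᵢ Dv)
      ... | no _ | yes A≼v = inj₂ (between⇒Pair A≼v v≼B)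
      ... | no ¬Dv | no A⋠v = inj₁ (L∪L⊆I (↓B∖[D∪↑A]⊆L∪L ¬Dv A⋠v v≼B))

    U∪Pair∈𝓘ᵢ₊₂ : InIdj (suc (suc i)) (U i ∪ Pair i)
    U∪Pair∈𝓘ᵢ₊₂ = ideal , inj₂ (B , (i+1<k , refl) , inj₂ B∈Pair) ,
      λ _ _ u∈C → IsC∩D⇒≤ u∈C ∘ C∩[U∪Pair]⊆D₂ u∈C
      where
      ideal : IsIdeal (U i ∪ Pair i)
      ideal v≼u (inj₁ Uu) = inj₁ (U-isIdeal v≼u Uu)
      ideal {v = v} v≼u (inj₂ Pu) with A ≼? v
      ... | yes A≼v = inj₂ (between⇒Pair A≼v (≼-trans v≼u (proj₂ (Pair⇒between Pu))))
      ... | no A⋠v = inj₁ (A⋠v ∘ proj₂)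
      C∩[U∪Pair]⊆D₂ : ∀ {m u} → IsC m u → (U i ∪ Pair i) u → D (suc (suc i)) u
      C∩[U∪Pair]⊆D₂ u∈C (inj₁ Uu) = D-mono (ℕ.m≤n+m i 2) i+1<k (IsC∖CLe⇒D u∈C i<k Uu)
      C∩[U∪Pair]⊆D₂ _ (inj₂ Pu) = ≼C⇒D i+1<k (proj₂ (Pair⇒between Pu))

    U∖D₂-isIdealOf : IsIdealOf (Psub (suc (suc i))) (U i ∖ D (suc (suc i)))
    U∖D₂-isIdealOf = ∖-isIdealOf U-isIdeal
      (λ (Uu , ¬Du) → ¬Du , Uu ∘ CLe-antimono (s≤s (ℕ.m≤n+m i 2))) proj₁

    ↑A∖Pair⇒∉C : ∀ {I u} → InIdj (suc (suc i)) I → I u → A ≼ u → ¬ Pair i u → ¬ InC u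
    ↑A∖Pair⇒∉C {u = u} I∈𝓘ᵢ₊₂ Iu A≼u ¬Pu u∈C = let (m , u≡cₘ) = InC⇒IsC u∈C in
      ¬Pu (D₂∩↑A⊆Pair A≼u (IsC⇒D u≡cₘ (proj₂ (proj₂ I∈𝓘ᵢ₊₂) m u u≡cₘ Iu) i+1<k))

    ↑A∖Pair⊆S∪S : ∀ {I u} → InIdj (suc (suc i)) I → I u → A ≼ u → ¬ Pair i u →
      (S (suc i) ∪ S (suc (suc i))) u
    ↑A∖Pair⊆S∪S {u = u} I∈𝓘ᵢ₊₂ Iu A≼u ¬Pu with B ≼? u
    ... | yes B≼u = inj₂ (↑A∖Pair⇒∉C I∈𝓘ᵢ₊₂ Iu A≼u ¬Pu ,
                          SIs-intro (i+1<k , B≼u) (ℕ.<-irrefl refl ∘ InIdj⇒CLe-bound I∈𝓘ᵢ₊₂ Iu))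
    ... | no B⋠u = inj₁ (↑A∖Pair⇒∉C I∈𝓘ᵢ₊₂ Iu A≼u ¬Pu , SIs-intro (i<k , A≼u) (B⋠u ∘ proj₂))

    ∖Pair-isIdeal⇔ : ∀ I → InIdj (suc (suc i)) I →
      IsIdeal (I ∖ Pair i) ⇔ Empty ((S (suc i) ∪ S (suc (suc i))) ∩ I)
    ∖Pair-isIdeal⇔ I I∈𝓘ᵢ₊₂ = mk⇔ S∪S∩I-empty λ S∪S∩I-empty v≼u (Iu , ¬Pu) →
      proj₁ I∈𝓘ᵢ₊₂ v≼u Iu , λ Pv →
        S∪S∩I-empty _ (↑A∖Pair⊆S∪S I∈𝓘ᵢ₊₂ Iu (≼-trans (proj₁ (Pair⇒between Pv)) v≼u) ¬Pu , Iu)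
      where
      S∪S∩I-empty : IsIdeal (I ∖ Pair i) → Empty ((S (suc i) ∪ S (suc (suc i))) ∩ I)
      S∪S∩I-empty J-ideal u (Su , Iu) =
        proj₂ (J-ideal (S∪S⇒A≼ Su) (Iu , [ proj₁ , proj₁ ]′ Su ∘ Pair⇒InC)) A∈Pair

    D₂∖Pair∈𝓘ᵢ : InIdj i (D (suc (suc i)) ∖ Pair i)
    D₂∖Pair∈𝓘ᵢ = ideal , D⊆⇒ζ≥ (ℕ.<⇒≤ i<k) Dᵢ⊆D₂∖Pair ,
      λ _ _ u∈C (Du , ¬Pu) → IsC∩D⇒≤ u∈C (IsC∖CLe⇒D u∈C i<k λ (_ , A≼u) → ¬Pu (D₂∩↑A⊆Pair A≼u Du))
      where
      ideal : IsIdeal (D (suc (suc i)) ∖ Pair i)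
      ideal v≼u (Du , ¬Pu) = D-isIdeal v≼u Du ,
        λ Pv → ¬Pu (D₂∩↑A⊆Pair (≼-trans (proj₁ (Pair⇒between Pv)) v≼u) Du)
      Dᵢ⊆D₂∖Pair : D i ⊆ D (suc (suc i)) ∖ Pair i
      Dᵢ⊆D₂∖Pair Du = D-mono (ℕ.m≤n+m i 2) i+1<k Du ,
        λ Pu → ℕ.n≮n i (IsC∩D⇒≤ (i<k , refl) (D-isIdeal (proj₁ (Pair⇒between Pu)) Du))

    D₂∖[D∪Pair]-isIdealOf : IsIdealOf (Psub i) (D (suc (suc i)) ∖ (D i ∪ Pair i))
    D₂∖[D∪Pair]-isIdealOf = ∖-isIdealOf D-isIdeal
      (λ (Du , ¬D∪Pu) → ¬D∪Pu ∘ inj₁ , λ (_ , A≼u) → ¬D∪Pu (inj₂ (D₂∩↑A⊆Pair A≼u Du)))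
      (λ (¬Du , ¬A≼u) → [ ¬Du , ¬A≼u ∘ (i<k ,_) ∘ proj₁ ∘ Pair⇒between ]′)

lemma3p4 : ∀ {n} (_≼_ : Rel (Fin n) 0ℓ) → IsPartialOrder _≡_ _≼_ → Decidable _≼_ →
    ∀ {k} (c : Fin k → Fin n) → IsLongestChain _≼_ c →
    ∀ (i : ℕ) → i + 2 ≤ k →
    let open Notation _≼_ c in
    ((∀ (I : Pred (Fin n) 0ℓ) → InIdj i I →
        (IsIdeal (I ∪ Pair i) ⇔ ((L (suc i) ∪ L (suc (suc i))) ⊆ I)))
     × InIdj (suc (suc i)) (U i ∪ Pair i)
     × IsIdealOf (Psub (suc (suc i))) (U i ∖ D (suc (suc i))))
    ×
    ((∀ (I : Pred (Fin n) 0ℓ) → InIdj (suc (suc i)) I →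
        (IsIdeal (I ∖ Pair i) ⇔ Empty ((S (suc i) ∪ S (suc (suc i))) ∩ I)))
     × InIdj i (D (suc (suc i)) ∖ Pair i)
     × IsIdealOf (Psub i) (D (suc (suc i)) ∖ (D i ∪ Pair i)))
lemma3p4 _ po _≼?_ {k} _ longest i i+2≤k =
  (∪Pair-isIdeal⇔ , U∪Pair∈𝓘ᵢ₊₂ , U∖D₂-isIdealOf) ,
  (∖Pair-isIdeal⇔ , D₂∖Pair∈𝓘ᵢ , D₂∖[D∪Pair]-isIdealOf)
  where
  open LongestChain po _≼?_ longest
  open Consecutive i (subst (_≤ k) (ℕ.+-comm i 2) i+2≤k)
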